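{- Let $S$ be the period-doubling word, the fixed point of the morphism $\sigma$ on $\{0,1\}$ defined by $\sigma(0) = 01$, $\sigma(1) = 00$. Then $\mathcal P^{(1)}_S(n) = O(\log n)$ as $n \to \infty$, and for all integers $m \geq 0$, \[ \mathcal P^{(1)}_S\!\left(\frac{2 \cdot 4^m + 1}{3}\right) = m + 2 \qquad\text{and}\qquad \mathcal P^{(1)}_S(2^m) = 2. \]
   Context: Two finite words are Abelian equivalent if each letter occurs the same number of times in both. For an infinite word $w$, $\mathcal P^{(1)}_w(n)$ is the number of Abelian equivalence classes among the factors of $w$ of length $n$. -}

module Defs where

import Data.Nat

open import Data.Nat using (ℕ; zero; suc; _+_; _*_; _<_; _≤_; _^_; _/_)
open import Data.Nat.Properties using (+-identityʳ; ≤-trans; n≤1+n; <-≤-trans; +-monoʳ-<; +-mono-≤; m≤m+n)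
open import Data.Nat.Logarithm using (⌊log₂_⌋)
open import Data.Fin using (Fin; zero; suc; toℕ; fromℕ<)
open import Data.Fin.Properties using () renaming (_≟_ to _≟ᶠ_)
open import Data.List using (List; []; _∷_; _++_; concatMap; length; lookup)
open import Data.List.Properties using (length-++)
open import Data.Vec using (Vec; tabulate; count)
open import Data.List.Relation.Unary.All using (All)
open import Data.List.Relation.Unary.Any using (Any)
open import Data.List.Relation.Unary.AllPairs using (AllPairs)
open import Data.Product using (Σ; ∃; ∃-syntax; _×_; _,_)
open import Relation.Binary.PropositionalEquality using (_≡_; refl; cong; subst; sym; trans)
open import Relation.Nullary using (¬_)

-- Binary alphabet {0,1}: zero = letter 0, suc zero = letter 1
Letter : Set
Letter = Fin 2

Word : Set
Word = ℕ → Letter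

σ : Letter → List Letter
σ zero       = zero ∷ suc zero ∷ []
σ (suc zero) = zero ∷ zero ∷ []

σ* : List Letter → List Letter
σ* = concatMap σ

σ^ : ℕ → List Letter
σ^ zero    = zero ∷ []
σ^ (suc k) = σ* (σ^ k)

n<2^n : ∀ n → n < 2 ^ n
n<2^n zero    = Data.Nat.s≤s Data.Nat.z≤n
n<2^n (suc n) = +-mono-≤ (1≤2^ n) (≤-trans (n<2^n n) (m≤m+n (2 ^ n) 0))
  where
  1≤2^ : ∀ k → 1 ≤ 2 ^ k
  1≤2^ zero = Data.Nat.s≤s Data.Nat.z≤n
  1≤2^ (suc k) = ≤-trans (1≤2^ k) (m≤m+n (2 ^ k) _)

lenσ* : ∀ xs → length (σ* xs) ≡ length xs + length xs
lenσ* [] = refl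
lenσ* (zero ∷ xs) = cong suc (trans (cong suc (lenσ* xs)) (sym (Data.Nat.Properties.+-suc (length xs) (length xs))))
  where import Data.Nat.Properties
lenσ* (suc zero ∷ xs) = cong suc (trans (cong suc (lenσ* xs)) (sym (Data.Nat.Properties.+-suc (length xs) (length xs))))
  where import Data.Nat.Properties

σ^-length : ∀ k → length (σ^ k) ≡ 2 ^ k
σ^-length zero    = refl
σ^-length (suc k) = trans (lenσ* (σ^ k))
  (trans (cong (λ t → t + t) (σ^-length k)) (cong (2 ^ k +_) (sym (+-identityʳ (2 ^ k)))))

-- Since σ(0) begins with 0, σ^k(0) is a prefix of σ^(k+1)(0); the fixed
-- point S = lim σ^k(0).  Its i-th letter is the i-th letter of σ^(i+1)(0),
-- which has length 2^(i+1) > i.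
periodDoubling : Word
periodDoubling i = lookup (σ^ (suc i))
  (subst Fin (sym (σ^-length (suc i)))
    (fromℕ< (<-≤-trans (n<2^n i) (Data.Nat.Properties.m≤m+n (2 ^ i) _))))
  where import Data.Nat.Properties

factor : Word → (i n : ℕ) → Vec Letter n
factor w i n = tabulate (λ j → w (i + toℕ j))

occ : ∀ {n} → Letter → Vec Letter n → ℕ
occ a u = count (_≟ᶠ a) u

AbelianEquiv : ∀ {n} → Vec Letter n → Vec Letter n → Set
AbelianEquiv u v = ∀ a → occ a u ≡ occ a v

IsFactor : Word → ∀ {n} → Vec Letter n → Set
IsFactor w {n} u = ∃[ i ] factor w i n ≡ u

-- AbelianComplexity w n k  :⇔  𝒫⁽¹⁾_w(n) = k, i.e. the factors of w of
-- length n fall into exactly k Abelian equivalence classes: there is a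
-- list of k factors of length n, pairwise non-Abelian-equivalent, such
-- that every factor of length n is Abelian equivalent to one of them.
AbelianComplexity : Word → ℕ → ℕ → Set
AbelianComplexity w n k =
  Σ (List (Vec Letter n)) λ reps →
      length reps ≡ k
    × All (IsFactor w) reps
    × AllPairs (λ u v → ¬ AbelianEquiv u v) reps
    × (∀ i → Any (AbelianEquiv (factor w i n)) reps)

module Submission where

-- S(2j) = 0 and S(2j+1) = 1 − S(j). Writing ones i n for the number of 1s in the factor
-- of length n at position i, this gives ones (2j) (2n) = n − ones j n, and for odd
-- lengths ones (2j) (2n+1) = n − ones j n and ones (2j+1) (2n+1) = n + 1 − ones j (n+1).
-- Sliding a factor by one position changes its number of 1s by at most one, so these
-- numbers fill an interval [lo, hi] and 𝒫⁽¹⁾(n) = hi − lo + 1.  The recurrences move the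
-- interval: at length 2n it is [n − hi, n − lo], at length 2n+1 the hull of the images
-- of the intervals at n and n+1.  Iterating from length 1 gives the intervals at 2^m and
-- (2·4^m+1)/3 exactly; for the logarithmic bound the same recurrences show by induction
-- that |3 · ones i n − n| ≤ 3 + log₂ (n − 1), which bounds hi − lo.

open import Defs
open import Data.Nat using (ℕ; zero; suc; _+_; _*_; _∸_; _≤_; _<_; _^_; _/_; _⊓_; _⊔_; z≤n; s≤s)
open import Data.Nat.Properties
open import Data.Nat.Induction using (<-rec)
open import Algebra.Properties.CommutativeSemigroup +-commutativeSemigroup using (interchange)
open import Data.Nat.Logarithm using (⌊log₂_⌋; ⌊log₂⌋-mono-≤; ⌊log₂[2*b]⌋≡1+⌊log₂b⌋)
open import Data.Nat.DivMod using (m*n/n≡m)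
open import Data.Nat.Tactic.RingSolver using (solve-∀; solve)
open import Data.Fin using (Fin; zero; suc; toℕ; fromℕ<)
open import Data.Fin.Properties using (toℕ-fromℕ<; toℕ<n)
open import Data.List using (List; []; _∷_; length; lookup)
open import Data.Vec as Vec using (Vec)
open import Data.Vec.Properties using (tabulate-cong)
open import Data.List.Relation.Unary.All as All using (All)
open import Data.List.Relation.Unary.Any using (Any; here; there)
open import Data.List.Relation.Unary.AllPairs as AllPairs using (AllPairs)
open import Data.Product using (∃-syntax; _×_; _,_; proj₁; proj₂)
open import Data.Sum using (_⊎_; inj₁; inj₂)
open import Relation.Nullary using (¬_; yes; no; contradiction)
open import Relation.Binary.PropositionalEquality

data Halving : ℕ → Set where
  even : ∀ j → Halving (j + j)
  odd  : ∀ j → Halving (suc (j + j))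

halving : ∀ n → Halving n
halving zero = even zero
halving (suc n) with halving n
... | even j = odd j
... | odd j  = subst Halving (cong suc (+-suc j j)) (even (suc j))

module _ (P : ℕ → Set) (P0 : P 0) (P1 : P 1)
         (P-even : ∀ n → P (suc n) → P (suc n + suc n))
         (P-odd : ∀ n → P (suc n) → P (suc (suc n)) → P (suc (suc n + suc n))) where

  binary-induction : ∀ n → P n
  binary-induction = <-rec P step
    where
    1+n<2+2n : ∀ n → suc n < suc n + suc n
    1+n<2+2n n = s≤s (m≤n+m (suc n) n)
    step : ∀ n → (∀ {m} → m < n → P m) → P n
    step n rec with halving n
    ... | even zero    = P0
    ... | odd zero     = P1
    ... | even (suc j) = P-even j (rec (1+n<2+2n j))
    ... | odd (suc j)  = P-odd j (rec (m<n⇒m<1+n (1+n<2+2n j))) (rec (s≤s (1+n<2+2n j)))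

flip : Letter → Letter
flip zero       = suc zero
flip (suc zero) = zero

-- Lookup in a finite word, with junk value 0 past its end.
_!_ : List Letter → ℕ → Letter
[]       ! _     = zero
(x ∷ xs) ! zero  = x
(x ∷ xs) ! suc i = xs ! i

lookup-! : ∀ xs (f : Fin (length xs)) → lookup xs f ≡ xs ! toℕ f
lookup-! (x ∷ xs) zero    = refl
lookup-! (x ∷ xs) (suc f) = lookup-! xs f

toℕ-subst : ∀ {m n} (e : m ≡ n) (x : Fin m) → toℕ (subst Fin e x) ≡ toℕ x
toℕ-subst refl x = refl

σ*-!-even : ∀ xs j → σ* xs ! (j + j) ≡ zero
σ*-!-even []             j       = refl
σ*-!-even (zero ∷ xs)     zero    = refl
σ*-!-even (suc zero ∷ xs) zero    = refl
σ*-!-even (zero ∷ xs)     (suc j) rewrite +-suc j j = σ*-!-even xs j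
σ*-!-even (suc zero ∷ xs) (suc j) rewrite +-suc j j = σ*-!-even xs j

σ*-!-odd : ∀ xs j → j < length xs → σ* xs ! suc (j + j) ≡ flip (xs ! j)
σ*-!-odd (zero ∷ xs)     zero    _       = refl
σ*-!-odd (suc zero ∷ xs) zero    _       = refl
σ*-!-odd (zero ∷ xs)     (suc j) (s≤s p) rewrite +-suc j j = σ*-!-odd xs j p
σ*-!-odd (suc zero ∷ xs) (suc j) (s≤s p) rewrite +-suc j j = σ*-!-odd xs j p

<-σ^-length : ∀ {i} k → i < 2 ^ k → i < length (σ^ k)
<-σ^-length {i} k = subst (i <_) (sym (σ^-length k))

<2^-suc : ∀ {i} k → i < 2 ^ k → i < 2 ^ suc k
<2^-suc {i} k p = <-≤-trans p (m≤m+n (2 ^ k) _)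

odd<2^-suc : ∀ {j} k → j < 2 ^ k → suc (j + j) < 2 ^ suc k
odd<2^-suc {j} k j<2^k = begin-strict
  suc (j + j)        <⟨ n<1+n _ ⟩
  suc (suc (j + j))  ≡⟨ solve (j ∷ []) ⟩
  2 * suc j          ≤⟨ *-monoʳ-≤ 2 j<2^k ⟩
  2 ^ suc k          ∎
  where open ≤-Reasoning

odd<2^-suc⁻¹ : ∀ {j} k → suc (j + j) < 2 ^ suc k → j < 2 ^ k
odd<2^-suc⁻¹ {j} k p = *-cancelˡ-< 2 j (2 ^ k) (begin-strict
  2 * j         ≡⟨ cong (j +_) (+-identityʳ j) ⟩
  j + j         <⟨ <-trans (n<1+n (j + j)) p ⟩
  2 ^ suc k     ∎)
  where open ≤-Reasoning

σ^-prefix : ∀ k i → i < 2 ^ k → σ^ (suc k) ! i ≡ σ^ k ! i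
σ^-prefix zero    zero    _ = refl
σ^-prefix zero    (suc i) (s≤s ())
σ^-prefix (suc k) i       p with halving i
... | even j = trans (σ*-!-even (σ^ (suc k)) j) (sym (σ*-!-even (σ^ k) j))
... | odd j  = begin
  σ* (σ^ (suc k)) ! suc (j + j) ≡⟨ σ*-!-odd (σ^ (suc k)) j (<-σ^-length (suc k) (<2^-suc k j<2^k)) ⟩
  flip (σ^ (suc k) ! j)         ≡⟨ cong flip (σ^-prefix k j j<2^k) ⟩
  flip (σ^ k ! j)               ≡⟨ sym (σ*-!-odd (σ^ k) j (<-σ^-length k j<2^k)) ⟩
  σ* (σ^ k) ! suc (j + j)       ∎
  where
  open ≡-Reasoning
  j<2^k = odd<2^-suc⁻¹ k p

σ^-stable : ∀ d k i → i < 2 ^ k → σ^ (d + k) ! i ≡ σ^ k ! i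
σ^-stable zero    k i p = refl
σ^-stable (suc d) k i p =
  trans (σ^-prefix (d + k) i (<-≤-trans p (^-monoʳ-≤ 2 (m≤n+m k d)))) (σ^-stable d k i p)

S : Word
S = periodDoubling

S-σ^ : ∀ k i → i < 2 ^ k → S i ≡ σ^ k ! i
S-σ^ k i p = begin
  S i                  ≡⟨ lookup-! (σ^ (suc i)) _ ⟩
  σ^ (suc i) ! toℕ f   ≡⟨ cong (σ^ (suc i) !_) (trans (toℕ-subst _ _) (toℕ-fromℕ< _)) ⟩
  σ^ (suc i) ! i       ≡⟨ sym (σ^-stable k (suc i) i (<2^-suc i (n<2^n i))) ⟩
  σ^ (k + suc i) ! i   ≡⟨ cong (λ e → σ^ e ! i) (+-comm k (suc i)) ⟩
  σ^ (suc i + k) ! i   ≡⟨ σ^-stable (suc i) k i p ⟩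
  σ^ k ! i             ∎
  where
  open ≡-Reasoning
  f = subst Fin (sym (σ^-length (suc i))) (fromℕ< (<-≤-trans (n<2^n i) (m≤m+n (2 ^ i) _)))

S-even : ∀ j → S (j + j) ≡ zero
S-even j = trans (S-σ^ (suc (j + j)) (j + j) (<2^-suc (j + j) (n<2^n (j + j)))) (σ*-!-even (σ^ (j + j)) j)

S-odd : ∀ j → S (suc (j + j)) ≡ flip (S j)
S-odd j = begin
  S (suc (j + j))               ≡⟨ S-σ^ (suc (suc j)) _ (odd<2^-suc (suc j) j<2^[1+j]) ⟩
  σ* (σ^ (suc j)) ! suc (j + j) ≡⟨ σ*-!-odd (σ^ (suc j)) j (<-σ^-length (suc j) j<2^[1+j]) ⟩
  flip (σ^ (suc j) ! j)         ≡⟨ cong flip (sym (S-σ^ (suc j) j j<2^[1+j])) ⟩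
  flip (S j)                    ∎
  where
  open ≡-Reasoning
  j<2^[1+j] = <2^-suc j (n<2^n j)

occ₁-∷ : ∀ {n} x (v : Vec Letter n) → occ (suc zero) (x Vec.∷ v) ≡ toℕ x + occ (suc zero) v
occ₁-∷ zero       v = refl
occ₁-∷ (suc zero) v = refl

occ₀+occ₁ : ∀ {n} (v : Vec Letter n) → occ zero v + occ (suc zero) v ≡ n
occ₀+occ₁ Vec.[]             = refl
occ₀+occ₁ (zero Vec.∷ v)     = cong suc (occ₀+occ₁ v)
occ₀+occ₁ (suc zero Vec.∷ v) = trans (+-suc _ _) (cong suc (occ₀+occ₁ v))

occ₁-≡⇒AbelianEquiv : ∀ {n} (u v : Vec Letter n) → occ (suc zero) u ≡ occ (suc zero) v → AbelianEquiv u v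
occ₁-≡⇒AbelianEquiv u v e zero = +-cancelʳ-≡ (occ (suc zero) u) _ _ (begin
  occ zero u + occ (suc zero) u  ≡⟨ trans (occ₀+occ₁ u) (sym (occ₀+occ₁ v)) ⟩
  occ zero v + occ (suc zero) v  ≡⟨ cong (occ zero v +_) (sym e) ⟩
  occ zero v + occ (suc zero) u  ∎)
  where open ≡-Reasoning
occ₁-≡⇒AbelianEquiv u v e (suc zero) = e

ones : Word → ℕ → ℕ → ℕ
ones w i zero    = 0
ones w i (suc n) = toℕ (w i) + ones w (suc i) n

module _ (w : Word) where

  factor-suc : ∀ i n → factor w i (suc n) ≡ w i Vec.∷ factor w (suc i) n
  factor-suc i n = cong₂ Vec._∷_ (cong w (+-identityʳ i)) (tabulate-cong (λ j → cong w (+-suc i (toℕ j))))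

  occ₁-factor : ∀ i n → occ (suc zero) (factor w i n) ≡ ones w i n
  occ₁-factor i zero    = refl
  occ₁-factor i (suc n) = begin
    occ (suc zero) (factor w i (suc n))              ≡⟨ cong (occ (suc zero)) (factor-suc i n) ⟩
    occ (suc zero) (w i Vec.∷ factor w (suc i) n)    ≡⟨ occ₁-∷ (w i) (factor w (suc i) n) ⟩
    toℕ (w i) + occ (suc zero) (factor w (suc i) n)  ≡⟨ cong (toℕ (w i) +_) (occ₁-factor (suc i) n) ⟩
    ones w i (suc n)                                 ∎
    where open ≡-Reasoning

  ones-≤ : ∀ i n → ones w i n ≤ n
  ones-≤ i zero    = z≤n
  ones-≤ i (suc n) = +-mono-≤ (≤-pred (toℕ<n (w i))) (ones-≤ (suc i) n)

  ones-snoc : ∀ i n → ones w i (suc n) ≡ ones w i n + toℕ (w (i + n))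
  ones-snoc i zero    = trans (+-identityʳ _) (cong (λ j → toℕ (w j)) (sym (+-identityʳ i)))
  ones-snoc i (suc n) = begin
    toℕ (w i) + ones w (suc i) (suc n)                   ≡⟨ cong (toℕ (w i) +_) (ones-snoc (suc i) n) ⟩
    toℕ (w i) + (ones w (suc i) n + toℕ (w (suc i + n))) ≡⟨ sym (+-assoc (toℕ (w i)) _ _) ⟩
    ones w i (suc n) + toℕ (w (suc i + n))               ≡⟨ cong (λ j → ones w i (suc n) + toℕ (w j)) (sym (+-suc i n)) ⟩
    ones w i (suc n) + toℕ (w (i + suc n))               ∎
    where open ≡-Reasoning

  ones-shift : ∀ i n → w i ≡ w (i + n) → ones w (suc i) n ≡ ones w i n
  ones-shift i n e = +-cancelˡ-≡ (toℕ (w i)) _ _ (begin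
    toℕ (w i) + ones w (suc i) n      ≡⟨ ones-snoc i n ⟩
    ones w i n + toℕ (w (i + n))      ≡⟨ cong (λ x → ones w i n + toℕ x) (sym e) ⟩
    ones w i n + toℕ (w i)            ≡⟨ +-comm (ones w i n) _ ⟩
    toℕ (w i) + ones w i n            ∎)
    where open ≡-Reasoning

  ones-drop-last : ∀ i n → w (i + n) ≡ zero → ones w i (suc n) ≡ ones w i n
  ones-drop-last i n e = trans (ones-snoc i n) (trans (cong (λ x → ones w i n + toℕ x) e) (+-identityʳ _))

  ones-suc-≤ : ∀ i n → ones w (suc i) n ≤ suc (ones w i n)
  ones-suc-≤ i n = begin
    ones w (suc i) n                 ≤⟨ m≤n+m _ (toℕ (w i)) ⟩
    toℕ (w i) + ones w (suc i) n     ≡⟨ ones-snoc i n ⟩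
    ones w i n + toℕ (w (i + n))     ≤⟨ +-monoʳ-≤ (ones w i n) (≤-pred (toℕ<n (w (i + n)))) ⟩
    ones w i n + 1                   ≡⟨ +-comm (ones w i n) 1 ⟩
    suc (ones w i n)                 ∎
    where open ≤-Reasoning

  ones-≤-suc : ∀ i n → ones w i n ≤ suc (ones w (suc i) n)
  ones-≤-suc i n = begin
    ones w i n                       ≤⟨ m≤m+n _ (toℕ (w (i + n))) ⟩
    ones w i n + toℕ (w (i + n))     ≡⟨ sym (ones-snoc i n) ⟩
    toℕ (w i) + ones w (suc i) n     ≤⟨ +-monoˡ-≤ (ones w (suc i) n) (≤-pred (toℕ<n (w i))) ⟩
    suc (ones w (suc i) n)           ∎
    where open ≤-Reasoning

module _ (f : ℕ → ℕ) where

  intermediate-value-up : (∀ i → f (suc i) ≤ suc (f i)) →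
                          ∀ d x v → f x ≤ v → v ≤ f (x + d) → ∃[ i ] f i ≡ v
  intermediate-value-up step zero x v p q = x , ≤-antisym p (subst (λ y → v ≤ f y) (+-identityʳ x) q)
  intermediate-value-up step (suc d) x v p q with f x ≟ v
  ... | yes e  = x , e
  ... | no f≢v = intermediate-value-up step d (suc x) v (≤-trans (step x) (≤∧≢⇒< p f≢v))
                   (subst (λ y → v ≤ f y) (+-suc x d) q)

  intermediate-value-down : (∀ i → f i ≤ suc (f (suc i))) →
                            ∀ d x v → v ≤ f x → f (x + d) ≤ v → ∃[ i ] f i ≡ v
  intermediate-value-down step zero x v p q = x , ≤-antisym (subst (λ y → f y ≤ v) (+-identityʳ x) q) p
  intermediate-value-down step (suc d) x v p q with f x ≟ v
  ... | yes e  = x , e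
  ... | no f≢v = intermediate-value-down step d (suc x) v (≤-pred (≤-trans (≤∧≢⇒< p (≢-sym f≢v)) (step x)))
                   (subst (λ y → f y ≤ v) (+-suc x d) q)

  intermediate-value : (∀ i → f (suc i) ≤ suc (f i)) → (∀ i → f i ≤ suc (f (suc i))) →
                       ∀ a c v → f a ≤ v → v ≤ f c → ∃[ i ] f i ≡ v
  intermediate-value up down a c v p q with ≤-total a c
  ... | inj₁ a≤c = intermediate-value-up up (c ∸ a) a v p (subst (λ y → v ≤ f y) (sym (m+[n∸m]≡n a≤c)) q)
  ... | inj₂ c≤a = intermediate-value-down down (a ∸ c) c v q (subst (λ y → f y ≤ v) (sym (m+[n∸m]≡n c≤a)) p)

module AbelianClasses (w : Word) {n lo W : ℕ} (rep : ℕ → ℕ)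
         (ones-rep : ∀ s → s ≤ W → ones w (rep s) n ≡ lo + s)
         (lower : ∀ i → lo ≤ ones w i n) (upper : ∀ i → ones w i n ≤ lo + W) where

  classes : ℕ → List (Vec Letter n)
  classes zero    = []
  classes (suc t) = factor w (rep t) n ∷ classes t

  length-classes : ∀ t → length (classes t) ≡ t
  length-classes zero    = refl
  length-classes (suc t) = cong suc (length-classes t)

  classes-factors : ∀ t → All (IsFactor w) (classes t)
  classes-factors zero    = All.[]
  classes-factors (suc t) = (rep t , refl) All.∷ classes-factors t

  occ₁-rep : ∀ t → t ≤ W → occ (suc zero) (factor w (rep t) n) ≡ lo + t
  occ₁-rep t t≤W = trans (occ₁-factor w (rep t) n) (ones-rep t t≤W)

  classes-below : ∀ t → t ≤ suc W → All (λ u → occ (suc zero) u < lo + t) (classes t)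
  classes-below zero    _ = All.[]
  classes-below (suc t) p =
    ≤-trans (s≤s (≤-reflexive (occ₁-rep t (≤-pred p)))) (≤-reflexive (sym (+-suc lo t)))
    All.∷ All.map (λ q → ≤-trans q (+-monoʳ-≤ lo (n≤1+n t))) (classes-below t (m≤n⇒m≤1+n (≤-pred p)))

  classes-distinct : ∀ t → t ≤ suc W → AllPairs (λ u v → ¬ AbelianEquiv u v) (classes t)
  classes-distinct zero    _ = AllPairs.[]
  classes-distinct (suc t) p =
    All.map (λ q eq → <-irrefl (trans (sym (eq (suc zero))) (occ₁-rep t (≤-pred p))) q)
            (classes-below t (m≤n⇒m≤1+n (≤-pred p)))
    AllPairs.∷ classes-distinct t (m≤n⇒m≤1+n (≤-pred p))

  classes-cover : ∀ t → t ≤ suc W → ∀ i → ones w i n < lo + t → Any (AbelianEquiv (factor w i n)) (classes t)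
  classes-cover zero    _ i q = contradiction (lower i) (<⇒≱ (subst (ones w i n <_) (+-identityʳ lo) q))
  classes-cover (suc t) p i q with ones w i n ≟ lo + t
  ... | yes e = here (occ₁-≡⇒AbelianEquiv (factor w i n) (factor w (rep t) n)
                       (trans (occ₁-factor w i n) (trans e (sym (occ₁-rep t (≤-pred p))))))
  ... | no ≢  = there (classes-cover t (m≤n⇒m≤1+n (≤-pred p)) i
                       (≤∧≢⇒< (≤-pred (subst (ones w i n <_) (+-suc lo t) q)) ≢))

  abelianComplexity : AbelianComplexity w n (suc W)
  abelianComplexity =
    classes (suc W) , length-classes (suc W) , classes-factors (suc W) , classes-distinct (suc W) ≤-refl ,
    λ i → classes-cover (suc W) ≤-refl i (≤-trans (s≤s (upper i)) (≤-reflexive (sym (+-suc lo W))))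

record Range (w : Word) (n lo hi : ℕ) : Set where
  field
    lower       : ∀ i → lo ≤ ones w i n
    upper       : ∀ i → ones w i n ≤ hi
    argmin      : ℕ
    ones-argmin : ones w argmin n ≡ lo
    argmax      : ℕ
    ones-argmax : ones w argmax n ≡ hi

  lo≤hi : lo ≤ hi
  lo≤hi = ≤-trans (lower 0) (upper 0)

  hi≤n : hi ≤ n
  hi≤n = subst (_≤ n) ones-argmax (ones-≤ w argmax n)

  lo≤n : lo ≤ n
  lo≤n = ≤-trans lo≤hi hi≤n

  ones-onto : ∀ v → lo ≤ v → v ≤ hi → ∃[ i ] ones w i n ≡ v
  ones-onto v p q = intermediate-value (λ i → ones w i n) (λ i → ones-suc-≤ w i n) (λ i → ones-≤-suc w i n)
    argmin argmax v (subst (_≤ v) (sym ones-argmin) p) (subst (v ≤_) (sym ones-argmax) q)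

  abelianComplexity : AbelianComplexity w n (suc (hi ∸ lo))
  abelianComplexity = AbelianClasses.abelianComplexity w rep ones-rep lower
    (λ i → subst (ones w i n ≤_) (sym (m+[n∸m]≡n lo≤hi)) (upper i))
    where
    attained : ∀ s → s ≤ hi ∸ lo → ∃[ i ] ones w i n ≡ lo + s
    attained s s≤W = ones-onto (lo + s) (m≤m+n lo s) (≤-trans (+-monoʳ-≤ lo s≤W) (≤-reflexive (m+[n∸m]≡n lo≤hi)))
    rep : ℕ → ℕ
    rep s with s ≤? hi ∸ lo
    ... | yes s≤W = proj₁ (attained s s≤W)
    ... | no _    = 0
    ones-rep : ∀ s → s ≤ hi ∸ lo → ones w (rep s) n ≡ lo + s
    ones-rep s s≤W with s ≤? hi ∸ lo
    ... | yes s≤W = proj₂ (attained s s≤W)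
    ... | no s≰W  = contradiction s≤W s≰W

toℕ-flip : ∀ x → toℕ (flip x) + toℕ x ≡ 1
toℕ-flip zero       = refl
toℕ-flip (suc zero) = refl

ones-odd-start : ∀ j n → ones S (suc (j + j)) (suc (n + n)) ≡ toℕ (flip (S j)) + ones S (suc j + suc j) (n + n)
ones-odd-start j n rewrite S-odd j | +-suc j j = refl

mutual
  ones-even-even : ∀ j n → ones S (j + j) (n + n) + ones S j n ≡ n
  ones-even-even j zero    = refl
  ones-even-even j (suc n) rewrite +-suc n n | S-even j = ones-odd-odd j n

  ones-odd-odd : ∀ j n → ones S (suc (j + j)) (suc (n + n)) + ones S j (suc n) ≡ suc n
  ones-odd-odd j n = begin
    ones S (suc (j + j)) (suc (n + n)) + ones S j (suc n)
      ≡⟨ cong (_+ ones S j (suc n)) (ones-odd-start j n) ⟩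
    (toℕ (flip (S j)) + ones S (suc j + suc j) (n + n)) + (toℕ (S j) + ones S (suc j) n)
      ≡⟨ interchange (toℕ (flip (S j))) _ (toℕ (S j)) _ ⟩
    (toℕ (flip (S j)) + toℕ (S j)) + (ones S (suc j + suc j) (n + n) + ones S (suc j) n)
      ≡⟨ cong₂ _+_ (toℕ-flip (S j)) (ones-even-even (suc j) n) ⟩
    suc n ∎
    where open ≡-Reasoning

S-even+even : ∀ j n → S ((j + j) + (n + n)) ≡ zero
S-even+even j n = trans (cong S (interchange j j n n)) (S-even (j + n))

ones-odd-even : ∀ j n → ones S (suc (j + j)) (n + n) + ones S j n ≡ n
ones-odd-even j n = trans (cong (_+ ones S j n) (ones-shift S (j + j) (n + n) (trans (S-even j) (sym (S-even+even j n)))))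
                          (ones-even-even j n)

ones-even-odd : ∀ j n → ones S (j + j) (suc (n + n)) + ones S j n ≡ n
ones-even-odd j n = trans (cong (_+ ones S j n) (ones-drop-last S (j + j) (n + n) (S-even+even j n)))
                          (ones-even-even j n)

module _ {x y s : ℕ} (x+y≡s : x + y ≡ s) where

  complement-lower : ∀ {lo h} → lo + h ≤ s → y ≤ h → lo ≤ x
  complement-lower {lo} {h} p q = +-cancelʳ-≤ h lo x (≤-trans p (≤-trans (≤-reflexive (sym x+y≡s)) (+-monoʳ-≤ x q)))

  complement-upper : ∀ {hi l} → s ≤ hi + l → l ≤ y → x ≤ hi
  complement-upper {hi} {l} p q = +-cancelʳ-≤ y x hi (≤-trans (≤-reflexive x+y≡s) (≤-trans p (+-monoʳ-≤ hi q)))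

  complement-exact : ∀ {z c} → y ≡ c → z + c ≡ s → x ≡ z
  complement-exact {z} refl z+c≡s = +-cancelʳ-≡ y x z (trans x+y≡s (sym z+c≡s))

module _ {a b s s′ : ℕ} (a≤s : a ≤ s) (b≤s′ : b ≤ s′) where

  ⊓-complement : let lo = (s ∸ a) ⊓ (s′ ∸ b) in
                 lo + a ≤ s × lo + b ≤ s′ × (lo + a ≡ s ⊎ lo + b ≡ s′)
  ⊓-complement = ≤-trans (+-monoˡ-≤ a (m⊓n≤m _ _)) (≤-reflexive (m∸n+n≡m a≤s))
               , ≤-trans (+-monoˡ-≤ b (m⊓n≤n _ _)) (≤-reflexive (m∸n+n≡m b≤s′))
               , attained (⊓-sel (s ∸ a) (s′ ∸ b))
    where
    attained : ∀ {lo} → lo ≡ s ∸ a ⊎ lo ≡ s′ ∸ b → lo + a ≡ s ⊎ lo + b ≡ s′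
    attained (inj₁ refl) = inj₁ (m∸n+n≡m a≤s)
    attained (inj₂ refl) = inj₂ (m∸n+n≡m b≤s′)

  ⊔-complement : let hi = (s ∸ a) ⊔ (s′ ∸ b) in
                 s ≤ hi + a × s′ ≤ hi + b × (hi + a ≡ s ⊎ hi + b ≡ s′)
  ⊔-complement = ≤-trans (≤-reflexive (sym (m∸n+n≡m a≤s))) (+-monoˡ-≤ a (m≤m⊔n _ _))
               , ≤-trans (≤-reflexive (sym (m∸n+n≡m b≤s′))) (+-monoˡ-≤ b (m≤n⊔m _ _))
               , attained (⊔-sel (s ∸ a) (s′ ∸ b))
    where
    attained : ∀ {hi} → hi ≡ s ∸ a ⊎ hi ≡ s′ ∸ b → hi + a ≡ s ⊎ hi + b ≡ s′
    attained (inj₁ refl) = inj₁ (m∸n+n≡m a≤s)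
    attained (inj₂ refl) = inj₂ (m∸n+n≡m b≤s′)

Range-even : ∀ {n lo hi lo′ hi′} → Range S n lo hi → lo′ + hi ≡ n → hi′ + lo ≡ n → Range S (n + n) lo′ hi′
Range-even {n} {lo′ = lo′} {hi′} R e₁ e₂ = record
  { lower = lower′ ; upper = upper′
  ; argmin = argmax + argmax ; ones-argmin = complement-exact (ones-even-even argmax n) ones-argmax e₁
  ; argmax = argmin + argmin ; ones-argmax = complement-exact (ones-even-even argmin n) ones-argmin e₂
  }
  where
  open Range R
  lower′ : ∀ i → lo′ ≤ ones S i (n + n)
  lower′ i with halving i
  ... | even j = complement-lower (ones-even-even j n) (≤-reflexive e₁) (upper j)
  ... | odd j  = complement-lower (ones-odd-even j n) (≤-reflexive e₁) (upper j)
  upper′ : ∀ i → ones S i (n + n) ≤ hi′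
  upper′ i with halving i
  ... | even j = complement-upper (ones-even-even j n) (≤-reflexive (sym e₂)) (lower j)
  ... | odd j  = complement-upper (ones-odd-even j n) (≤-reflexive (sym e₂)) (lower j)

-- The hypotheses say lo = min (n − h) (n + 1 − h′) and hi = max (n − l) (n + 1 − l′).
Range-odd : ∀ {n l h l′ h′ lo hi} → Range S n l h → Range S (suc n) l′ h′ →
            lo + h ≤ n → lo + h′ ≤ suc n → lo + h ≡ n ⊎ lo + h′ ≡ suc n →
            n ≤ hi + l → suc n ≤ hi + l′ → hi + l ≡ n ⊎ hi + l′ ≡ suc n →
            Range S (suc (n + n)) lo hi
Range-odd {n} {l} {h} {l′} {h′} {lo} {hi} R R′ p₁ p₂ p q₁ q₂ q = record
  { lower = lower′ ; upper = upper′
  ; argmin = proj₁ (min-attained p) ; ones-argmin = proj₂ (min-attained p)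
  ; argmax = proj₁ (max-attained q) ; ones-argmax = proj₂ (max-attained q)
  }
  where
  module R = Range R
  module R′ = Range R′
  lower′ : ∀ i → lo ≤ ones S i (suc (n + n))
  lower′ i with halving i
  ... | even j = complement-lower (ones-even-odd j n) p₁ (R.upper j)
  ... | odd j  = complement-lower (ones-odd-odd j n) p₂ (R′.upper j)
  upper′ : ∀ i → ones S i (suc (n + n)) ≤ hi
  upper′ i with halving i
  ... | even j = complement-upper (ones-even-odd j n) q₁ (R.lower j)
  ... | odd j  = complement-upper (ones-odd-odd j n) q₂ (R′.lower j)
  min-attained : lo + h ≡ n ⊎ lo + h′ ≡ suc n → ∃[ i ] ones S i (suc (n + n)) ≡ lo
  min-attained (inj₁ e) = R.argmax + R.argmax , complement-exact (ones-even-odd R.argmax n) R.ones-argmax e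
  min-attained (inj₂ e) = suc (R′.argmax + R′.argmax) , complement-exact (ones-odd-odd R′.argmax n) R′.ones-argmax e
  max-attained : hi + l ≡ n ⊎ hi + l′ ≡ suc n → ∃[ i ] ones S i (suc (n + n)) ≡ hi
  max-attained (inj₁ e) = R.argmin + R.argmin , complement-exact (ones-even-odd R.argmin n) R.ones-argmin e
  max-attained (inj₂ e) = suc (R′.argmin + R′.argmin) , complement-exact (ones-odd-odd R′.argmin n) R′.ones-argmin e

Range-odd-sameLow : ∀ {n l h h′ lo hi} → Range S n l h → Range S (suc n) l h′ → h′ ≤ suc h →
                    lo + h ≡ n → hi + l ≡ suc n → Range S (suc (n + n)) lo hi
Range-odd-sameLow {n} {l} {h} {h′} {lo} {hi} R R′ h′≤1+h e₁ e₂ =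
  Range-odd R R′ (≤-reflexive e₁) lo+h′≤1+n (inj₁ e₁)
                 (≤-trans (n≤1+n n) (≤-reflexive (sym e₂))) (≤-reflexive (sym e₂)) (inj₂ e₂)
  where
  lo+h′≤1+n : lo + h′ ≤ suc n
  lo+h′≤1+n = ≤-trans (+-monoʳ-≤ lo h′≤1+h) (≤-reflexive (trans (+-suc lo h) (cong suc e₁)))

range-0 : Range S 0 0 0
range-0 = record { lower = λ _ → z≤n ; upper = λ _ → z≤n
                 ; argmin = 0 ; ones-argmin = refl ; argmax = 0 ; ones-argmax = refl }

range-1 : Range S 1 0 1
range-1 = record { lower = λ _ → z≤n ; upper = λ i → ones-≤ S i 1
                 ; argmin = 0 ; ones-argmin = cong (λ x → toℕ x + 0) (S-even 0)
                 ; argmax = 1 ; ones-argmax = cong (λ x → toℕ x + 0) (S-odd 0) }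

range-2^ : ∀ m → ∃[ lo ] Range S (2 ^ m) lo (suc lo)
range-2^ zero    = 0 , range-1
range-2^ (suc m) with range-2^ m
... | lo , R = 2 ^ m ∸ suc lo ,
  subst (λ k → Range S k (2 ^ m ∸ suc lo) (suc (2 ^ m ∸ suc lo))) (cong (2 ^ m +_) (sym (+-identityʳ (2 ^ m))))
        (Range-even R lo′+hi≡n (trans (sym (+-suc _ lo)) lo′+hi≡n))
  where
  lo′+hi≡n : 2 ^ m ∸ suc lo + suc lo ≡ 2 ^ m
  lo′+hi≡n = m∸n+n≡m (Range.hi≤n R)

abelianComplexity-2^ : ∀ m → AbelianComplexity S (2 ^ m) 2
abelianComplexity-2^ m with range-2^ m
... | lo , R = subst (AbelianComplexity S (2 ^ m)) (cong suc (m+n∸n≡m 1 lo)) (Range.abelianComplexity R)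

-- q m = (4^m − 1)/3
q : ℕ → ℕ
q zero    = 0
q (suc m) = suc ((q m + q m) + (q m + q m))

QuarterRanges : ℕ → Set
QuarterRanges m = ∃[ l ] q m ≡ 3 * l + m × Range S (q m) l (l + m) × Range S (suc (q m + q m)) (l + l) (l + l + suc m)

quarterRanges-step : ∀ l m p → p ≡ 3 * l + m →
  Range S p l (l + m) → Range S (suc (p + p)) (l + l) (l + l + suc m) →
  let p′ = suc ((p + p) + (p + p)) ; l′ = 4 * l + m in
  p′ ≡ 3 * l′ + suc m × Range S p′ l′ (l′ + suc m) × Range S (suc (p′ + p′)) (l′ + l′) (l′ + l′ + suc (suc m))
quarterRanges-step l m .(3 * l + m) refl R[p] R[2p+1] =
  solve (l ∷ m ∷ []) , R[4p+1] ,
  Range-odd-sameLow R[4p+1] R[4p+2] (n≤1+n _) (solve (l ∷ m ∷ [])) (solve (l ∷ m ∷ []))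
  where
  R[2p] : Range S ((3 * l + m) + (3 * l + m)) (l + l) (l + l + m)
  R[2p] = Range-even R[p] (solve (l ∷ m ∷ [])) (solve (l ∷ m ∷ []))
  R[4p+1] : Range S (suc (((3 * l + m) + (3 * l + m)) + ((3 * l + m) + (3 * l + m)))) (4 * l + m) (4 * l + m + suc m)
  R[4p+1] = Range-odd-sameLow R[2p] R[2p+1] (≤-reflexive (+-suc _ m)) (solve (l ∷ m ∷ [])) (solve (l ∷ m ∷ []))
  R[4p+2] : Range S (suc (suc (((3 * l + m) + (3 * l + m)) + ((3 * l + m) + (3 * l + m))))) (4 * l + m) (4 * l + m + suc m)
  R[4p+2] = subst (λ k → Range S k (4 * l + m) (4 * l + m + suc m)) (cong suc (+-suc _ _)) doubled
    where
    doubled : Range S (suc ((3 * l + m) + (3 * l + m)) + suc ((3 * l + m) + (3 * l + m))) (4 * l + m) (4 * l + m + suc m)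
    doubled = Range-even R[2p+1] (solve (l ∷ m ∷ [])) (solve (l ∷ m ∷ []))

quarterRanges : ∀ m → QuarterRanges m
quarterRanges zero    = 0 , refl , range-0 , range-1
quarterRanges (suc m) with quarterRanges m
... | l , q≡3l+m , R[q] , R[2q+1] = 4 * l + m , quarterRanges-step l m (q m) q≡3l+m R[q] R[2q+1]

3q+1≡4^ : ∀ m → 3 * q m + 1 ≡ 4 ^ m
3q+1≡4^ zero    = refl
3q+1≡4^ (suc m) = trans (expand (q m)) (cong (4 *_) (3q+1≡4^ m))
  where
  expand : ∀ x → 3 * suc ((x + x) + (x + x)) + 1 ≡ 4 * (3 * x + 1)
  expand = solve-∀

[2*4^m+1]/3≡1+2q : ∀ m → (2 * 4 ^ m + 1) / 3 ≡ suc (q m + q m)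
[2*4^m+1]/3≡1+2q m = begin
  (2 * 4 ^ m + 1) / 3          ≡⟨ cong (λ x → (2 * x + 1) / 3) (sym (3q+1≡4^ m)) ⟩
  (2 * (3 * q m + 1) + 1) / 3  ≡⟨ cong (_/ 3) (expand (q m)) ⟩
  suc (q m + q m) * 3 / 3      ≡⟨ m*n/n≡m (suc (q m + q m)) 3 ⟩
  suc (q m + q m)              ∎
  where
  open ≡-Reasoning
  expand : ∀ x → 2 * (3 * x + 1) + 1 ≡ suc (x + x) * 3
  expand = solve-∀

abelianComplexity-quarter : ∀ m → AbelianComplexity S ((2 * 4 ^ m + 1) / 3) (m + 2)
abelianComplexity-quarter m with quarterRanges m
... | l , _ , _ , R[2q+1] = subst₂ (AbelianComplexity S) (sym ([2*4^m+1]/3≡1+2q m))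
  (trans (cong suc (m+n∸m≡n (l + l) (suc m))) (+-comm 2 m)) (Range.abelianComplexity R[2q+1])

range-exists : ∀ n → ∃[ lo ] ∃[ hi ] Range S n lo hi
range-exists = binary-induction (λ n → ∃[ lo ] ∃[ hi ] Range S n lo hi)
                 (0 , 0 , range-0) (0 , 1 , range-1) even-step odd-step
  where
  even-step : ∀ n → ∃[ lo ] ∃[ hi ] Range S (suc n) lo hi → ∃[ lo ] ∃[ hi ] Range S (suc n + suc n) lo hi
  even-step n (lo , hi , R) = suc n ∸ hi , suc n ∸ lo ,
    Range-even R (m∸n+n≡m (Range.hi≤n R)) (m∸n+n≡m (Range.lo≤n R))
  odd-step : ∀ n → ∃[ lo ] ∃[ hi ] Range S (suc n) lo hi → ∃[ lo ] ∃[ hi ] Range S (suc (suc n)) lo hi →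
             ∃[ lo ] ∃[ hi ] Range S (suc (suc n + suc n)) lo hi
  odd-step n (l , h , R) (l′ , h′ , R′)
    with ⊓-complement (Range.hi≤n R) (Range.hi≤n R′) | ⊔-complement (Range.lo≤n R) (Range.lo≤n R′)
  ... | p₁ , p₂ , p | q₁ , q₂ , q = _ , _ , Range-odd R R′ p₁ p₂ p q₁ q₂ q

record _≈⅓_±_ (x n k : ℕ) : Set where
  constructor near
  field
    upper : 3 * x ≤ n + k
    lower : n ≤ 3 * x + k

≈⅓-mono : ∀ {x n k k′} → k ≤ k′ → x ≈⅓ n ± k → x ≈⅓ n ± k′
≈⅓-mono {x} {n} k≤k′ (near p q) = near (≤-trans p (+-monoʳ-≤ n k≤k′)) (≤-trans q (+-monoʳ-≤ (3 * x) k≤k′))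

≈⅓-suc : ∀ {x n k} → x ≈⅓ n ± k → x ≈⅓ suc n ± suc k
≈⅓-suc {x} {n} {k} (near p q) =
  near (≤-trans p (+-mono-≤ (n≤1+n n) (n≤1+n k))) (≤-trans (s≤s q) (≤-reflexive (sym (+-suc (3 * x) k))))

≈⅓-pred : ∀ {x n k} → x ≈⅓ suc n ± k → x ≈⅓ n ± suc k
≈⅓-pred {x} {n} {k} (near p q) =
  near (≤-trans p (≤-reflexive (sym (+-suc n k)))) (≤-trans (n≤1+n n) (≤-trans q (+-monoʳ-≤ (3 * x) (n≤1+n k))))

≈⅓-complement : ∀ {x y s k} → x + y ≡ s → y ≈⅓ s ± k → x ≈⅓ s + s ± k
≈⅓-complement {x} {y} {s} {k} x+y≡s (near p q) = near upper lower
  where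
  open ≤-Reasoning
  3s≡3x+3y : 3 * s ≡ 3 * x + 3 * y
  3s≡3x+3y = trans (cong (3 *_) (sym x+y≡s)) (*-distribˡ-+ 3 x y)
  upper : 3 * x ≤ s + s + k
  upper = +-cancelʳ-≤ s _ _ (begin
    3 * x + s            ≤⟨ +-monoʳ-≤ (3 * x) q ⟩
    3 * x + (3 * y + k)  ≡⟨ sym (+-assoc (3 * x) _ k) ⟩
    3 * x + 3 * y + k    ≡⟨ cong (_+ k) (sym 3s≡3x+3y) ⟩
    3 * s + k            ≡⟨ solve (s ∷ k ∷ []) ⟩
    s + s + k + s        ∎)
  lower : s + s ≤ 3 * x + k
  lower = +-cancelʳ-≤ s _ _ (begin
    s + s + s            ≡⟨ solve (s ∷ []) ⟩
    3 * s                ≡⟨ 3s≡3x+3y ⟩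
    3 * x + 3 * y        ≤⟨ +-monoʳ-≤ (3 * x) p ⟩
    3 * x + (s + k)      ≡⟨ solve (x ∷ s ∷ k ∷ []) ⟩
    3 * x + k + s        ∎)

≈⅓-∸ : ∀ {a b n k} → a ≈⅓ n ± k → b ≈⅓ n ± k → b ∸ a ≤ k + k
≈⅓-∸ {a} {b} {n} {k} (near _ n≤3a+k) (near 3b≤n+k _) =
  ≤-trans (∸-monoˡ-≤ a b≤a+2k) (≤-reflexive (m+n∸m≡n a (k + k)))
  where
  open ≤-Reasoning
  b≤a+2k : b ≤ a + (k + k)
  b≤a+2k = *-cancelˡ-≤ 3 (begin
    3 * b                              ≤⟨ 3b≤n+k ⟩
    n + k                              ≤⟨ +-monoˡ-≤ k n≤3a+k ⟩
    3 * a + k + k                      ≤⟨ m≤m+n (3 * a + k + k) (k + k + (k + k)) ⟩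
    3 * a + k + k + (k + k + (k + k))  ≡⟨ solve (a ∷ k ∷ []) ⟩
    3 * (a + (k + k))                  ∎)

-- With n − 1 in place of n, slack (2n + 1) = 1 + slack (n + 1), as the odd case needs.
slack : ℕ → ℕ
slack n = 3 + ⌊log₂ (n ∸ 1) ⌋

slack-mono : ∀ {m n} → m ≤ n → slack m ≤ slack n
slack-mono m≤n = +-monoʳ-≤ 3 (⌊log₂⌋-mono-≤ (∸-monoˡ-≤ 1 m≤n))

slack-odd : ∀ n → slack (suc (suc n + suc n)) ≡ suc (slack (suc (suc n)))
slack-odd n = cong (3 +_) (trans (cong ⌊log₂_⌋ (cong (suc n +_) (sym (+-identityʳ (suc n)))))
                                 (⌊log₂[2*b]⌋≡1+⌊log₂b⌋ (suc n)))

ones-near-third : ∀ n i → ones S i n ≈⅓ n ± slack n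
ones-near-third = binary-induction (λ n → ∀ i → ones S i n ≈⅓ n ± slack n)
  (λ _ → near z≤n z≤n)
  (λ i → near (≤-trans (*-monoʳ-≤ 3 (ones-≤ S i 1)) (m≤n+m 3 1)) (≤-trans (s≤s z≤n) (m≤n+m 3 _)))
  even-step odd-step
  where
  even-step : ∀ n → (∀ i → ones S i (suc n) ≈⅓ suc n ± slack (suc n)) →
              ∀ i → ones S i (suc n + suc n) ≈⅓ suc n + suc n ± slack (suc n + suc n)
  even-step n near-n i with halving i
  ... | even j = ≈⅓-mono (slack-mono (m≤m+n (suc n) (suc n))) (≈⅓-complement (ones-even-even j (suc n)) (near-n j))
  ... | odd j  = ≈⅓-mono (slack-mono (m≤m+n (suc n) (suc n))) (≈⅓-complement (ones-odd-even j (suc n)) (near-n j))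
  odd-step : ∀ n → (∀ i → ones S i (suc n) ≈⅓ suc n ± slack (suc n)) →
             (∀ i → ones S i (suc (suc n)) ≈⅓ suc (suc n) ± slack (suc (suc n))) →
             ∀ i → ones S i (suc (suc n + suc n)) ≈⅓ suc (suc n + suc n) ± slack (suc (suc n + suc n))
  odd-step n near-n near-1+n i with halving i
  ... | even j = ≈⅓-mono (≤-trans (s≤s (slack-mono (n≤1+n (suc n)))) (≤-reflexive (sym (slack-odd n))))
                   (≈⅓-suc (≈⅓-complement (ones-even-odd j (suc n)) (near-n j)))
  ... | odd j  = ≈⅓-mono (≤-reflexive (sym (slack-odd n)))
                   (≈⅓-pred (subst (λ m → ones S (suc (j + j)) (suc (suc n + suc n)) ≈⅓ m ± slack (suc (suc n)))
                                   (cong suc (+-suc (suc n) (suc n)))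
                                   (≈⅓-complement (ones-odd-odd j (suc n)) (near-1+n j))))

range-width : ∀ {n lo hi} → Range S n lo hi → hi ∸ lo ≤ slack n + slack n
range-width {n} R = ≈⅓-∸ (subst (_≈⅓ n ± slack n) ones-argmin (ones-near-third n argmin))
                         (subst (_≈⅓ n ± slack n) ones-argmax (ones-near-third n argmax))
  where open Range R

1+2slack≤9⌊log₂⌋ : ∀ n → 2 ≤ n → suc (slack n + slack n) ≤ 9 * ⌊log₂ n ⌋
1+2slack≤9⌊log₂⌋ n 2≤n with ⌊log₂ n ⌋ | ⌊log₂⌋-mono-≤ 2≤n | ⌊log₂⌋-mono-≤ (m∸n≤m n 1)
... | zero  | ()  | _
... | suc L | s≤s _ | log[n-1]≤1+L = begin
  suc (slack n + slack n)                  ≤⟨ s≤s (+-mono-≤ (+-monoʳ-≤ 3 log[n-1]≤1+L) (+-monoʳ-≤ 3 log[n-1]≤1+L)) ⟩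
  suc ((3 + suc L) + (3 + suc L))          ≤⟨ m≤m+n _ (7 * L) ⟩
  suc ((3 + suc L) + (3 + suc L)) + 7 * L  ≡⟨ solve (L ∷ []) ⟩
  9 * suc L                                ∎
  where open ≤-Reasoning

abelianComplexity-log : ∃[ C ] ∃[ N ] ∀ n → N ≤ n → ∃[ k ] AbelianComplexity S n k × k ≤ C * ⌊log₂ n ⌋
abelianComplexity-log = 9 , 2 , bound
  where
  bound : ∀ n → 2 ≤ n → ∃[ k ] AbelianComplexity S n k × k ≤ 9 * ⌊log₂ n ⌋
  bound n 2≤n with range-exists n
  ... | lo , hi , R =
    suc (hi ∸ lo) , Range.abelianComplexity R , ≤-trans (s≤s (range-width R)) (1+2slack≤9⌊log₂⌋ n 2≤n)

lemma5 : (∃[ C ] ∃[ N ] ∀ n → N ≤ n →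
    ∃[ k ] AbelianComplexity periodDoubling n k × k ≤ C * ⌊log₂ n ⌋)
    × (∀ m → AbelianComplexity periodDoubling ((2 * 4 ^ m + 1) / 3) (m + 2))
    × (∀ m → AbelianComplexity periodDoubling (2 ^ m) 2)
lemma5 = abelianComplexity-log , abelianComplexity-quarter , abelianComplexity-2^
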